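{- Let $\nu\ge1$, $a=2^\nu+1$, $b=2^\nu-1$, $A_\nu=\log\bigl((a^\nu-1)/b\bigr)/\log(2)$, and let $T:\mathbb{N}\to\mathbb{N}$ be defined by $T(n)=n/2$ if $n$ is even and $T(n)=(an+b)/2$ if $n$ is odd. The cycle of length $\nu+A_\nu$ $$\Omega(b)=(b\rightarrow a2^{\nu-1}-1\rightarrow a^22^{\nu-2}-1\rightarrow\cdots\rightarrow a^\nu-1=2^{A_\nu}b\rightarrow2^{A_\nu-1}b\rightarrow\cdots\rightarrow2b\rightarrow b)$$ exists if and only if $A_\nu$ is an integer, which happens exactly for $\nu=1$ and $\nu=2$. Precisely: $T^{(\nu)}(b)=a^\nu-1=2^{A_\nu}b$; $A_\nu\in\mathbb{Z}$ iff $\nu\in\{1,2\}$; and in those cases $T^{(\nu+A_\nu)}(b)=b$ and the displayed orbit is a cycle of length $\nu+A_\nu$ (namely $(1\rightarrow2\rightarrow1)$ for $\nu=1$ and $(3\rightarrow9\rightarrow24\rightarrow12\rightarrow6\rightarrow3)$ for $\nu=2$).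
   Context: $T^{(k)}$ is the $k$-th iterate of $T$. A cycle of $T$ of length $k$ is a set $\{\omega,T(\omega),\dots,T^{(k-1)}(\omega)\}$ of $k$ distinct positive integers with $T^{(k)}(\omega)=\omega$. -}

module Defs where

open import Data.Nat using (ℕ; zero; suc; _+_; _*_; _∸_; _^_; _<_; _%_; _/_; _≡ᵇ_)
open import Data.Bool using (if_then_else_)
open import Data.Product using (_×_)
open import Relation.Binary.PropositionalEquality using (_≡_)

aν : ℕ → ℕ
aν ν = 2 ^ ν + 1

bν : ℕ → ℕ
bν ν = 2 ^ ν ∸ 1

T : ℕ → ℕ → ℕ
T ν n = if n % 2 ≡ᵇ 0 then n / 2 else (aν ν * n + bν ν) / 2

iter : (ℕ → ℕ) → ℕ → ℕ → ℕ
iter f zero    x = x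
iter f (suc k) x = f (iter f k x)

IsCycle : (ℕ → ℕ) → ℕ → ℕ → Set
IsCycle f k ω =
  (0 < k)
  × (∀ i → i < k → 0 < iter f i ω)
  × (∀ i j → i < k → j < k → iter f i ω ≡ iter f j ω → i ≡ j)
  × (iter f k ω ≡ ω)

-- "A_ν = log₂((a^ν - 1)/b) is an integer, equal to k":  a^ν - 1 = 2^k · b
AνIs : ℕ → ℕ → Set
AνIs ν k = aν ν ^ ν ∸ 1 ≡ 2 ^ k * bν ν

{-# OPTIONS --safe #-}
-- With x = 2^ν, T sends 2m − 1 to (x + 1) m − 1, so b = x − 1 climbs through a^i 2^(ν−i) − 1
-- to a^ν − 1, after which the orbit can only halve; it returns to b exactly when
-- a^ν − 1 = 2^k b.  For ν ≥ 3 such a k exceeds 2ν by size alone, so x² divides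
-- a^ν − 1 = (x + 1)^ν − 1 ≡ ν x (mod x²), forcing the impossible 2^ν ∣ ν.
module Submission where

open import Defs
open import Data.Nat using (ℕ; zero; suc; _+_; _*_; _∸_; _^_; _≤_; _<_; _%_; _/_; z≤n; s≤s; _≟_; _<?_; >-nonZero)
open import Data.Nat.Properties
open import Data.Nat.DivMod using ([m+kn]%n≡m%n; m*n%n≡0; m*n/n≡m)
open import Data.Nat.Divisibility using (_∣_; ∣m+n∣m⇒∣n; m∣m*n; ∣m⇒∣m*n; *-cancelʳ-∣; ∣⇒≤)
open import Data.Nat.Logarithm using (⌊log₂_⌋; ⌊log₂[2^n]⌋≡n)
open import Data.Nat.Tactic.RingSolver using (solve-∀)
open import Data.Product using (_×_; ∃; _,_)
open import Data.Sum using (_⊎_; inj₁; inj₂)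
open import Data.List using (map; upTo; _∷_; [])
open import Function.Bundles using (_⇔_; mk⇔; Equivalence)
open import Relation.Nullary using (¬_; Dec; contradiction)
open import Relation.Nullary.Decidable using (_×-dec_; _→-dec_; map′; toWitness)
open import Relation.Binary.PropositionalEquality using (_≡_; refl; sym; trans; cong; subst; module ≡-Reasoning)

iter-+ : ∀ (f : ℕ → ℕ) m n x → iter f (m + n) x ≡ iter f n (iter f m x)
iter-+ f m zero    x = cong (λ l → iter f l x) (+-identityʳ m)
iter-+ f m (suc n) x = trans (cong (λ l → iter f l x) (+-suc m n)) (cong f (iter-+ f m n x))

n<2^n : ∀ n → n < 2 ^ n
n<2^n zero    = s≤s z≤n
n<2^n (suc n) = +-mono-≤ (m^n>0 2 n) (≤-trans (n<2^n n) (m≤m+n (2 ^ n) 0))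

2^m<2^n⇒m<n : ∀ {m n} → 2 ^ m < 2 ^ n → m < n
2^m<2^n⇒m<n 2^m<2^n = ≰⇒> (λ n≤m → <⇒≱ 2^m<2^n (^-monoʳ-≤ 2 n≤m))

2^n≡2^m*2^[n∸m] : ∀ {m n} → m ≤ n → 2 ^ n ≡ 2 ^ m * 2 ^ (n ∸ m)
2^n≡2^m*2^[n∸m] {m} {n} m≤n = trans (cong (2 ^_) (sym (m+[n∸m]≡n m≤n))) (^-distribˡ-+-* 2 m (n ∸ m))

2^m∣2^n : ∀ {m n} → m ≤ n → 2 ^ m ∣ 2 ^ n
2^m∣2^n {m} {n} m≤n = subst (2 ^ m ∣_) (sym (2^n≡2^m*2^[n∸m] m≤n)) (m∣m*n (2 ^ (n ∸ m)))

[x+1]^n≡1+nx+x²c : ∀ x n → ∃ λ c → (x + 1) ^ n ≡ 1 + n * x + x * x * c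
[x+1]^n≡1+nx+x²c x zero    = 0 , base x
  where
  base : ∀ x → 1 ≡ 1 + 0 * x + x * x * 0
  base = solve-∀
[x+1]^n≡1+nx+x²c x (suc n) with [x+1]^n≡1+nx+x²c x n
... | c , expansion = n + x * c + c , trans (cong ((x + 1) *_) expansion) (step x n c)
  where
  step : ∀ x n c → (x + 1) * (1 + n * x + x * x * c) ≡ 1 + suc n * x + x * x * (n + x * c + c)
  step = solve-∀

T-of-even : ∀ ν n → n % 2 ≡ 0 → T ν n ≡ n / 2
T-of-even ν n n%2≡0 rewrite n%2≡0 = refl

T-of-odd : ∀ ν n → n % 2 ≡ 1 → T ν n ≡ (aν ν * n + bν ν) / 2
T-of-odd ν n n%2≡1 rewrite n%2≡1 = refl

T-even : ∀ ν m → T ν (2 * m) ≡ m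
T-even ν m = begin
  T ν (2 * m)   ≡⟨ cong (T ν) (*-comm 2 m) ⟩
  T ν (m * 2)   ≡⟨ T-of-even ν (m * 2) (m*n%n≡0 m 2) ⟩
  m * 2 / 2     ≡⟨ m*n/n≡m m 2 ⟩
  m             ∎
  where open ≡-Reasoning

odd-step : ∀ N q → 0 < N → ((N + 1) * (1 + q * 2) + (N ∸ 1)) / 2 ≡ (N + 1) * suc q ∸ 1
odd-step (suc M) q _ = begin
  ((suc M + 1) * (1 + q * 2) + M) / 2  ≡⟨ cong (_/ 2) (doubled M q) ⟩
  ((suc M + 1) * q + suc M) * 2 / 2    ≡⟨ m*n/n≡m ((suc M + 1) * q + suc M) 2 ⟩
  (suc M + 1) * q + suc M              ≡⟨ cong (_∸ 1) (successor M q) ⟩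
  (suc M + 1) * suc q ∸ 1              ∎
  where
  open ≡-Reasoning
  doubled : ∀ M q → (suc M + 1) * (1 + q * 2) + M ≡ ((suc M + 1) * q + suc M) * 2
  doubled = solve-∀
  successor : ∀ M q → suc ((suc M + 1) * q + suc M) ≡ (suc M + 1) * suc q
  successor = solve-∀

T-odd : ∀ ν m → 0 < m → T ν (2 * m ∸ 1) ≡ aν ν * m ∸ 1
T-odd ν (suc q) _ = begin
  T ν (2 * suc q ∸ 1)                ≡⟨ cong (λ n → T ν (n ∸ 1)) (odd-form q) ⟩
  T ν (1 + q * 2)                    ≡⟨ T-of-odd ν (1 + q * 2) ([m+kn]%n≡m%n 1 q 2) ⟩
  (aν ν * (1 + q * 2) + bν ν) / 2    ≡⟨ odd-step (2 ^ ν) q (m^n>0 2 ν) ⟩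
  aν ν * suc q ∸ 1                   ∎
  where
  open ≡-Reasoning
  odd-form : ∀ q → 2 * suc q ≡ suc (1 + q * 2)
  odd-form = solve-∀

2*p*m≡p*[2*m] : ∀ p m → 2 * p * m ≡ p * (2 * m)
2*p*m≡p*[2*m] = solve-∀

p*[2*m]≡2*[p*m] : ∀ p m → p * (2 * m) ≡ 2 * (p * m)
p*[2*m]≡2*[p*m] = solve-∀

orbit-climb : ∀ ν i m → 0 < m → iter (T ν) i (2 ^ i * m ∸ 1) ≡ aν ν ^ i * m ∸ 1
orbit-climb ν zero    m _   = refl
orbit-climb ν (suc i) m m>0 = begin
  T ν (iter (T ν) i (2 * 2 ^ i * m ∸ 1))    ≡⟨ cong (λ n → T ν (iter (T ν) i (n ∸ 1))) (2*p*m≡p*[2*m] (2 ^ i) m) ⟩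
  T ν (iter (T ν) i (2 ^ i * (2 * m) ∸ 1))  ≡⟨ cong (T ν) (orbit-climb ν i (2 * m) (*-monoʳ-< 2 m>0)) ⟩
  T ν (aν ν ^ i * (2 * m) ∸ 1)              ≡⟨ cong (λ n → T ν (n ∸ 1)) (p*[2*m]≡2*[p*m] (aν ν ^ i) m) ⟩
  T ν (2 * (aν ν ^ i * m) ∸ 1)              ≡⟨ T-odd ν (aν ν ^ i * m) (*-mono-≤ a^i>0 m>0) ⟩
  aν ν * (aν ν ^ i * m) ∸ 1                 ≡⟨ cong (_∸ 1) (sym (*-assoc (aν ν) (aν ν ^ i) m)) ⟩
  aν ν ^ suc i * m ∸ 1                      ∎
  where
  open ≡-Reasoning
  a^i>0 : 0 < aν ν ^ i
  a^i>0 = m^n>0 (aν ν) {{>-nonZero (m≤n+m 1 (2 ^ ν))}} i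

orbit-descend : ∀ ν j m → iter (T ν) j (2 ^ j * m) ≡ m
orbit-descend ν zero    m = *-identityˡ m
orbit-descend ν (suc j) m = begin
  T ν (iter (T ν) j (2 * 2 ^ j * m))    ≡⟨ cong (λ n → T ν (iter (T ν) j n)) (2*p*m≡p*[2*m] (2 ^ j) m) ⟩
  T ν (iter (T ν) j (2 ^ j * (2 * m)))  ≡⟨ cong (T ν) (orbit-descend ν j (2 * m)) ⟩
  T ν (2 * m)                           ≡⟨ T-even ν m ⟩
  m                                     ∎
  where open ≡-Reasoning

orbit-of-b : ∀ ν i → i ≤ ν → iter (T ν) i (bν ν) ≡ aν ν ^ i * 2 ^ (ν ∸ i) ∸ 1
orbit-of-b ν i i≤ν = begin
  iter (T ν) i (2 ^ ν ∸ 1)                    ≡⟨ cong (λ n → iter (T ν) i (n ∸ 1)) (2^n≡2^m*2^[n∸m] i≤ν) ⟩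
  iter (T ν) i (2 ^ i * 2 ^ (ν ∸ i) ∸ 1)      ≡⟨ orbit-climb ν i (2 ^ (ν ∸ i)) (m^n>0 2 (ν ∸ i)) ⟩
  aν ν ^ i * 2 ^ (ν ∸ i) ∸ 1                  ∎
  where open ≡-Reasoning

orbit-top : ∀ ν → iter (T ν) ν (bν ν) ≡ aν ν ^ ν ∸ 1
orbit-top ν = begin
  iter (T ν) ν (bν ν)              ≡⟨ orbit-of-b ν ν ≤-refl ⟩
  aν ν ^ ν * 2 ^ (ν ∸ ν) ∸ 1       ≡⟨ cong (λ e → aν ν ^ ν * 2 ^ e ∸ 1) (n∸n≡0 ν) ⟩
  aν ν ^ ν * 1 ∸ 1                 ≡⟨ cong (_∸ 1) (*-identityʳ (aν ν ^ ν)) ⟩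
  aν ν ^ ν ∸ 1                     ∎
  where open ≡-Reasoning

orbit-after-top : ∀ ν k → AνIs ν k → ∀ j → j ≤ k → iter (T ν) (ν + j) (bν ν) ≡ 2 ^ (k ∸ j) * bν ν
orbit-after-top ν k Aν≡k j j≤k = begin
  iter (T ν) (ν + j) (bν ν)                    ≡⟨ iter-+ (T ν) ν j (bν ν) ⟩
  iter (T ν) j (iter (T ν) ν (bν ν))           ≡⟨ cong (iter (T ν) j) (trans (orbit-top ν) Aν≡k) ⟩
  iter (T ν) j (2 ^ k * bν ν)                  ≡⟨ cong (λ n → iter (T ν) j (n * bν ν)) (2^n≡2^m*2^[n∸m] j≤k) ⟩
  iter (T ν) j (2 ^ j * 2 ^ (k ∸ j) * bν ν)    ≡⟨ cong (iter (T ν) j) (*-assoc (2 ^ j) (2 ^ (k ∸ j)) (bν ν)) ⟩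
  iter (T ν) j (2 ^ j * (2 ^ (k ∸ j) * bν ν))  ≡⟨ orbit-descend ν j (2 ^ (k ∸ j) * bν ν) ⟩
  2 ^ (k ∸ j) * bν ν                           ∎
  where open ≡-Reasoning

bν>0 : ∀ {ν} → 1 ≤ ν → 0 < bν ν
bν>0 1≤ν = m<n⇒0<n∸m (^-monoʳ-≤ 2 1≤ν)

Aν-exponent-unique : ∀ {ν k k′} → 1 ≤ ν → AνIs ν k → AνIs ν k′ → k ≡ k′
Aν-exponent-unique {ν} {k} {k′} 1≤ν Aν≡k Aν≡k′ = begin
  k               ≡⟨ sym (⌊log₂[2^n]⌋≡n k) ⟩
  ⌊log₂ 2 ^ k ⌋   ≡⟨ cong ⌊log₂_⌋ 2^k≡2^k′ ⟩
  ⌊log₂ 2 ^ k′ ⌋  ≡⟨ ⌊log₂[2^n]⌋≡n k′ ⟩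
  k′              ∎
  where
  open ≡-Reasoning
  2^k≡2^k′ : 2 ^ k ≡ 2 ^ k′
  2^k≡2^k′ = *-cancelʳ-≡ _ _ (bν ν) {{>-nonZero (bν>0 1≤ν)}} (trans (sym Aν≡k) Aν≡k′)

Aν-exponent-large : ∀ {ν} k → 3 ≤ ν → AνIs ν k → ν + ν ≤ k
Aν-exponent-large {ν} k 3≤ν Aν≡k = <⇒≤ (+-cancelʳ-< ν (ν + ν) k 3ν<k+ν)
  where
  open ≤-Reasoning
  x = 2 ^ ν
  2^νν<2^[k+ν] : 2 ^ (ν * ν) < 2 ^ (k + ν)
  2^νν<2^[k+ν] = begin-strict
    2 ^ (ν * ν)       ≡⟨ sym (^-*-assoc 2 ν ν) ⟩
    x ^ ν             ≤⟨ ∸-monoˡ-≤ 1 (^-monoˡ-< ν {{>-nonZero (≤-trans (s≤s z≤n) 3≤ν)}} (m<m+n x (s≤s z≤n))) ⟩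
    aν ν ^ ν ∸ 1      ≡⟨ Aν≡k ⟩
    2 ^ k * (x ∸ 1)   <⟨ *-monoʳ-< (2 ^ k) {{>-nonZero (m^n>0 2 k)}} (∸-monoʳ-< (s≤s z≤n) (m^n>0 2 ν)) ⟩
    2 ^ k * x         ≡⟨ sym (^-distribˡ-+-* 2 k ν) ⟩
    2 ^ (k + ν)       ∎
  3ν<k+ν : ν + ν + ν < k + ν
  3ν<k+ν = begin-strict
    ν + ν + ν   ≡⟨ thrice ν ⟩
    ν * 3       ≤⟨ *-monoʳ-≤ ν 3≤ν ⟩
    ν * ν       <⟨ 2^m<2^n⇒m<n 2^νν<2^[k+ν] ⟩
    k + ν       ∎
    where
    thrice : ∀ ν → ν + ν + ν ≡ ν * 3
    thrice = solve-∀

Aν-exponent-large⇒2^ν∣ν : ∀ {ν} k → ν + ν ≤ k → AνIs ν k → 2 ^ ν ∣ ν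
Aν-exponent-large⇒2^ν∣ν {ν} k 2ν≤k Aν≡k with [x+1]^n≡1+nx+x²c (2 ^ ν) ν
... | c , expansion = *-cancelʳ-∣ x {{>-nonZero (m^n>0 2 ν)}} x²∣νx
  where
  x = 2 ^ ν
  x²∣2^k : x * x ∣ 2 ^ k
  x²∣2^k = subst (_∣ 2 ^ k) (^-distribˡ-+-* 2 ν ν) (2^m∣2^n 2ν≤k)
  x²∣νx+x²c : x * x ∣ ν * x + x * x * c
  x²∣νx+x²c = subst (x * x ∣_) (trans (sym Aν≡k) (cong (_∸ 1) expansion)) (∣m⇒∣m*n (x ∸ 1) x²∣2^k)
  x²∣νx : x * x ∣ ν * x
  x²∣νx = ∣m+n∣m⇒∣n (subst (x * x ∣_) (+-comm (ν * x) (x * x * c)) x²∣νx+x²c) (m∣m*n c)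

Aν-not-integral : ∀ {ν} → 3 ≤ ν → ¬ (∃ λ k → AνIs ν k)
Aν-not-integral {ν} 3≤ν (k , Aν≡k) = <⇒≱ (n<2^n ν) 2^ν≤ν
  where
  2^ν≤ν : 2 ^ ν ≤ ν
  2^ν≤ν = ∣⇒≤ {{>-nonZero (≤-trans (s≤s z≤n) 3≤ν)}}
            (Aν-exponent-large⇒2^ν∣ν k (Aν-exponent-large k 3≤ν Aν≡k) Aν≡k)

Aν-integral⇔ν∈[1,2] : ∀ {ν} → 1 ≤ ν → (∃ λ k → AνIs ν k) ⇔ (ν ≡ 1 ⊎ ν ≡ 2)
Aν-integral⇔ν∈[1,2] 1≤ν = mk⇔ (integral⇒ 1≤ν) ⇐integral
  where
  integral⇒ : ∀ {ν} → 1 ≤ ν → (∃ λ k → AνIs ν k) → ν ≡ 1 ⊎ ν ≡ 2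
  integral⇒ {1}                   _ _        = inj₁ refl
  integral⇒ {2}                   _ _        = inj₂ refl
  integral⇒ {ν@(suc (suc (suc _)))} _ integral =
    contradiction integral (Aν-not-integral {ν} (s≤s (s≤s (s≤s z≤n))))
  ⇐integral : ∀ {ν} → ν ≡ 1 ⊎ ν ≡ 2 → ∃ λ k → AνIs ν k
  ⇐integral (inj₁ refl) = 1 , refl
  ⇐integral (inj₂ refl) = 3 , refl

orbit-returns : ∀ ν k → AνIs ν k → iter (T ν) (ν + k) (bν ν) ≡ bν ν
orbit-returns ν k Aν≡k = begin
  iter (T ν) (ν + k) (bν ν)   ≡⟨ orbit-after-top ν k Aν≡k k ≤-refl ⟩
  2 ^ (k ∸ k) * bν ν          ≡⟨ cong (λ e → 2 ^ e * bν ν) (n∸n≡0 k) ⟩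
  1 * bν ν                    ≡⟨ *-identityˡ (bν ν) ⟩
  bν ν                        ∎
  where open ≡-Reasoning

allBelow? : ∀ {P : ℕ → Set} → (∀ i → Dec (P i)) → ∀ k → Dec (∀ i → i < k → P i)
allBelow? P? k = map′ (λ all i → all {i}) (λ all {i} → all i) (allUpTo? P? k)

isCycle? : ∀ f k ω → Dec (IsCycle f k ω)
isCycle? f k ω =
        0 <? k
  ×-dec allBelow? (λ i → 0 <? iter f i ω) k
  ×-dec map′ (λ inj i j i<k j<k → inj i i<k j j<k) (λ inj i i<k j j<k → inj i j i<k j<k)
          (allBelow? (λ i → allBelow? (λ j → (iter f i ω ≟ iter f j ω) →-dec (i ≟ j)) k) k)
  ×-dec iter f k ω ≟ ω

Aν-cycle : ∀ ν k → 1 ≤ ν → AνIs ν k → IsCycle (T ν) (ν + k) (bν ν)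
Aν-cycle ν k 1≤ν Aν≡k with Equivalence.to (Aν-integral⇔ν∈[1,2] 1≤ν) (k , Aν≡k)
... | inj₁ refl = subst (λ k → IsCycle (T 1) (1 + k) 1) (Aν-exponent-unique {k = 1} 1≤ν refl Aν≡k)
                   (toWitness {a? = isCycle? (T 1) 2 1} _)
... | inj₂ refl = subst (λ k → IsCycle (T 2) (2 + k) 3) (Aν-exponent-unique {k = 3} 1≤ν refl Aν≡k)
                   (toWitness {a? = isCycle? (T 2) 5 3} _)

mainTheorem12 : ∀ (ν : ℕ) → 1 ≤ ν →
    (∀ i → i ≤ ν → iter (T ν) i (bν ν) ≡ aν ν ^ i * 2 ^ (ν ∸ i) ∸ 1)
  × (iter (T ν) ν (bν ν) ≡ aν ν ^ ν ∸ 1)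
  × ((∃ λ k → AνIs ν k) ⇔ (ν ≡ 1 ⊎ ν ≡ 2))
  × (∀ k → AνIs ν k →
        (∀ j → j ≤ k → iter (T ν) (ν + j) (bν ν) ≡ 2 ^ (k ∸ j) * bν ν)
      × iter (T ν) (ν + k) (bν ν) ≡ bν ν
      × IsCycle (T ν) (ν + k) (bν ν))
  × (ν ≡ 1 → AνIs 1 1 × map (λ i → iter (T 1) i 1) (upTo 2) ≡ 1 ∷ 2 ∷ [])
  × (ν ≡ 2 → AνIs 2 3 × map (λ i → iter (T 2) i 3) (upTo 5) ≡ 3 ∷ 9 ∷ 24 ∷ 12 ∷ 6 ∷ [])
mainTheorem12 ν 1≤ν =
    orbit-of-b ν
  , orbit-top ν
  , Aν-integral⇔ν∈[1,2] 1≤ν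
  , (λ k Aν≡k → orbit-after-top ν k Aν≡k , orbit-returns ν k Aν≡k , Aν-cycle ν k 1≤ν Aν≡k)
  , (λ _ → refl , refl)
  , (λ _ → refl , refl)
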